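{- Let $c\ge 1$ and let $I=(G,X,k)$ be an instance of a-$c$-tdmod-IS with $G=(V,E,\mathcal{H})$, $R=V\setminus X$. (Rule 1) If $u\in X$ satisfies ${\sf conf}_R(\{u\})>|X|$, then the instance obtained by deleting $u$ from the graph (removing it from $X$, along with incident edges and any hyperedges containing it) is equivalent to $I$. (Rule 2) If $X'\in\mathcal{X}$ satisfies ${\sf conf}_R(X')>|X|$, then the instance obtained by adding $X'$ to $\mathcal{H}$ is equivalent to $I$.
   Context: Treedepth ${\sf td}$: minimum height of a rooted forest whose closure (each vertex joined to all ancestors) contains the graph. An instance of a-$c$-tdmod-IS is $(G,X,k)$ where $G=(V,E,\mathcal{H})$ with $V=X\uplus R$, $E$ a set of 2-element edges each with one endpoint in $X$ and one in $R$ or both in $R$, $\mathcal{H}$ a set of hyperedges each contained in $X$, ${\sf td}(G[R])\le c$, and $k$ a positive integer; the question is whether $\alpha(G)\ge k$, where an independent set is a set $S\subseteq V$ with $h\not\subseteq S$ for all $h\in E\cup\mathcal{H}$ and $\alpha$ is the maximum size of one. Equivalent instances have the same answer. For $R'\subseteq R$, $\alpha(R')$ is the independence number of the graph $G[R']$; for $X'\subseteq X$, $N_{R'}(X')=\{v\in R' : \exists x\in X', \{x,v\}\in E\}$ and ${\sf conf}_{R'}(X')=\alpha(R')-\alpha(R'\setminus N_{R'}(X'))$. The set of chunks is $\mathcal{X}=\{X'\subseteq X : 0<|X'|\le 2^c \text{ and no } H\in\mathcal{H} \text{ satisfies } H\subseteq X'\}$. -}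

module Defs where

open import Data.Nat using (ℕ; zero; suc; _≤_; _<_; _∸_; _⊔_; _^_)
open import Data.Bool using (Bool; true; false; not; _∧_; _∨_)
open import Data.Fin using (Fin)
open import Data.Fin.Subset using (Subset; _∈_; _∉_; _⊆_; _─_; _-_; ∣_∣; ⁅_⁆; inside; outside)
open import Data.Fin.Subset.Properties using (_∈?_; _⊆?_)
open import Data.Vec using ([]; _∷_)
open import Data.List using (List; []; _∷_; map; filter; foldr; _++_)
open import Data.Bool.ListAction using (any; all)
import Data.List.Membership.Propositional as LM
open import Data.Maybe using (Maybe; just; nothing)
open import Data.Product using (Σ; _×_; _,_; proj₁; proj₂; ∃)
open import Data.Sum using (_⊎_)
open import Relation.Binary.PropositionalEquality using (_≡_; _≢_)
open import Relation.Nullary using (¬_; does)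

-- Vertices live in Fin n;
-- the actual vertex set is V ⊆ Fin n (so that deleting a vertex keeps
-- the same ambient type).  A 2-element edge {a,b} is a pair (a , b).
record Instance (n : ℕ) : Set where
  field
    V : Subset n
    X : Subset n
    E : List (Fin n × Fin n)
    H : List (Subset n)
    k : ℕ

R : ∀ {n} → Instance n → Subset n
R I = Instance.V I ─ Instance.X I

-- A rooted forest on S is given by a parent map together with a depth
-- function (depth of a root = 1, depth of a child = depth of parent + 1),
-- which forces acyclicity; its height is the maximum depth.

ParentOK : ∀ {n} → Subset n → (Fin n → ℕ) → Fin n → Maybe (Fin n) → Set
ParentOK S d v nothing  = d v ≡ 1
ParentOK S d v (just w) = (w ∈ S) × (suc (d w) ≡ d v)

data Anc {n} (par : Fin n → Maybe (Fin n)) (u : Fin n) : Fin n → Set where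
  anc-refl : Anc par u u
  anc-step : ∀ {v w} → par v ≡ just w → Anc par u w → Anc par u v

TdAtMost : ∀ {n} → ℕ → Subset n → List (Fin n × Fin n) → Set
TdAtMost {n} c S E =
  Σ (Fin n → Maybe (Fin n)) λ par → Σ (Fin n → ℕ) λ d →
    (∀ v → v ∈ S → ParentOK S d v (par v) × d v ≤ c) ×
    (∀ a b → (a , b) LM.∈ E → a ∈ S → b ∈ S → Anc par a b ⊎ Anc par b a)

ValidInstance : ∀ {n} → ℕ → Instance n → Set
ValidInstance c I =
  (X ⊆ V) ×
  (∀ a b → (a , b) LM.∈ E →
     (a ≢ b) × (a ∈ V) × (b ∈ V) × ¬ ((a ∈ X) × (b ∈ X))) ×
  (∀ h → h LM.∈ H → h ⊆ X) ×
  TdAtMost c (R I) E ×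
  (1 ≤ k)
  where open Instance I

Independent : ∀ {n} → Instance n → Subset n → Set
Independent I S =
  (S ⊆ V) ×
  (∀ a b → (a , b) LM.∈ E → ¬ ((a ∈ S) × (b ∈ S))) ×
  (∀ h → h LM.∈ H → ¬ (h ⊆ S))
  where open Instance I

Answer : ∀ {n} → Instance n → Set
Answer I = Σ _ λ S → Independent I S × (Instance.k I ≤ ∣ S ∣)

allSubsets : ∀ n → List (Subset n)
allSubsets zero    = [] ∷ []
allSubsets (suc n) = map (inside ∷_) (allSubsets n) ++ map (outside ∷_) (allSubsets n)

indepInB : ∀ {n} → List (Fin n × Fin n) → Subset n → Subset n → Bool
indepInB E R' S =
  does (S ⊆? R') ∧ all (λ e → not (does (proj₁ e ∈? S) ∧ does (proj₂ e ∈? S))) E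

αR : ∀ {n} → Instance n → Subset n → ℕ
αR {n} I R' = foldr (λ S m → ∣ S ∣ ⊔ m) 0
  (filter (λ S → indepInB (Instance.E I) R' S Data.Bool.≟ true) (allSubsets n))

adjacentTo : ∀ {n} → List (Fin n × Fin n) → Subset n → Fin n → Bool
adjacentTo E X' v =
  any (λ e → (does (proj₁ e ∈? X') ∧ does (proj₂ e Data.Fin.≟ v)) ∨
             (does (proj₂ e ∈? X') ∧ does (proj₁ e Data.Fin.≟ v))) E

N : ∀ {n} → Instance n → Subset n → Subset n → Subset n
N I R' X' = Data.Vec.tabulate λ v → Data.Vec.lookup R' v ∧ adjacentTo (Instance.E I) X' v

conf : ∀ {n} → Instance n → Subset n → Subset n → ℕ
conf I R' X' = αR I R' ∸ αR I (R' ─ N I R' X')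

Chunk : ∀ {n} → ℕ → Instance n → Subset n → Set
Chunk c I X' =
  (X' ⊆ Instance.X I) × (0 < ∣ X' ∣) × (∣ X' ∣ ≤ 2 ^ c) ×
  (∀ h → h LM.∈ Instance.H I → ¬ (h ⊆ X'))

incident : ∀ {n} → Fin n → Fin n × Fin n → Bool
incident u e = does (proj₁ e Data.Fin.≟ u) ∨ does (proj₂ e Data.Fin.≟ u)

deleteVertex : ∀ {n} → Fin n → Instance n → Instance n
deleteVertex u I = record
  { V = V - u
  ; X = X - u
  ; E = filter (λ e → incident u e Data.Bool.≟ false) E
  ; H = filter (λ h → does (u ∈? h) Data.Bool.≟ false) H
  ; k = k }
  where open Instance I

addHyperedge : ∀ {n} → Subset n → Instance n → Instance n
addHyperedge X' I = record I { H = X' ∷ Instance.H I }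

-- If S is independent and contains A, then S ─ X lies in R and avoids N_R(A), so
-- ∣S∣ ≤ ∣X∣ + α(R ─ N_R(A)), which is < α(R) as soon as conf_R(A) > ∣X∣. A maximum independent
-- set of G[R] is then a strictly larger independent set of G that meets X nowhere (hyperedges
-- lie in X), so an optimal solution never has to contain u, respectively all of X'.
module Submission where

open import Defs
open import Data.Nat using (ℕ; zero; suc; _≤_; _<_; _+_; _∸_; _⊔_; z≤n; s≤s)
open import Data.Nat.Properties
  using (≤-refl; ≤-reflexive; ≤-trans; <⇒≤; ≤-<-trans; <-≤-trans; n≤1+n; +-suc; +-identityʳ; +-monoʳ-≤;
         n≮0; m≤m⊔n; m≤n⊔m; ≤-total; m≥n⇒m⊔n≡m; m≤n⇒m⊔n≡n)
open import Data.Fin using (Fin) renaming (_≟_ to _≟ᶠ_)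
open import Data.Fin.Subset using (Subset; _∈_; _∉_; _⊆_; _─_; _∪_; ∣_∣; ⁅_⁆; inside; outside; Nonempty)
open import Data.Fin.Subset.Properties
  using (_∈?_; _⊆?_; nonempty?; Empty-unique; ∣⊥∣≡0; p─q⊆p; p⊆q⇒∣p∣≤∣q∣; x∈p∪q⁺; x∈p∧x∉q⇒x∈p─q; x∈p∧x≢y⇒x∈p-y;
         x∈⁅x⁆; x∈⁅y⁆⇒x≡y)
open import Data.Vec using ([]; _∷_; here; there; lookup)
open import Data.Vec.Properties using ([]=⇒lookup; lookup∘tabulate)
open import Data.List using (List; []; _∷_; map; foldr)
open import Data.List.Relation.Unary.Any using (Any)
import Data.List.Relation.Unary.All as All
open import Data.List.Relation.Unary.All.Properties using (all⁺; all⁻)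
open import Data.List.Relation.Unary.Any.Properties using (any⁻)
import Data.List.Membership.Propositional as List
open import Data.List.Membership.Propositional using (find)
open import Data.List.Membership.Propositional.Properties using (∈-filter⁺; ∈-filter⁻; ∈-map⁺; ∈-++⁺ˡ; ∈-++⁺ʳ)
open import Data.Bool using (true; false; T; not; _∧_) renaming (_≟_ to _≟ᵇ_)
open import Data.Bool.Properties using (T-≡; T-not-≡; T-∧; T-∨)
open import Data.Product using (∃-syntax; _×_; _,_; proj₁; proj₂)
open import Data.Sum using (_⊎_; inj₁; inj₂)
open import Data.Empty using (⊥-elim)
open import Relation.Nullary using (¬_; Dec; yes; no; does; _×-dec_)
open import Relation.Nullary.Decidable using (dec-true; dec-false)
open import Relation.Binary.PropositionalEquality using (_≡_; _≢_; refl; sym; trans; cong; subst)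
open import Function.Bundles using (_⇔_; mk⇔; Equivalence)
open Equivalence using (to; from)

private
  variable
    n : ℕ

x∈p─q⇒x∉q : ∀ {x : Fin n} {p q : Subset n} → x ∈ p ─ q → x ∉ q
x∈p─q⇒x∉q {p = _ ∷ _} {inside ∷ _} ()            here
x∈p─q⇒x∉q {p = _ ∷ _} {_      ∷ _} (there x∈p─q) (there x∈q) = x∈p─q⇒x∉q x∈p─q x∈q

x∈p⇒⁅x⁆⊆p : ∀ {x : Fin n} {p} → x ∈ p → ⁅ x ⁆ ⊆ p
x∈p⇒⁅x⁆⊆p {x = x} {p} x∈p y∈⁅x⁆ = subst (_∈ p) (sym (x∈⁅y⁆⇒x≡y x y∈⁅x⁆)) x∈p

∣p∪q∣≤∣p∣+∣q∣ : ∀ (p q : Subset n) → ∣ p ∪ q ∣ ≤ ∣ p ∣ + ∣ q ∣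
∣p∪q∣≤∣p∣+∣q∣ []            []            = z≤n
∣p∪q∣≤∣p∣+∣q∣ (inside  ∷ p) (inside  ∷ q) = s≤s (≤-trans (∣p∪q∣≤∣p∣+∣q∣ p q) (+-monoʳ-≤ ∣ p ∣ (n≤1+n ∣ q ∣)))
∣p∪q∣≤∣p∣+∣q∣ (inside  ∷ p) (outside ∷ q) = s≤s (∣p∪q∣≤∣p∣+∣q∣ p q)
∣p∪q∣≤∣p∣+∣q∣ (outside ∷ p) (inside  ∷ q) rewrite +-suc ∣ p ∣ ∣ q ∣ = s≤s (∣p∪q∣≤∣p∣+∣q∣ p q)
∣p∪q∣≤∣p∣+∣q∣ (outside ∷ p) (outside ∷ q) = ∣p∪q∣≤∣p∣+∣q∣ p q

∣p∣≤∣q∣+∣p─q∣ : ∀ (p q : Subset n) → ∣ p ∣ ≤ ∣ q ∣ + ∣ p ─ q ∣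
∣p∣≤∣q∣+∣p─q∣ p q = ≤-trans (p⊆q⇒∣p∣≤∣q∣ p⊆q∪[p─q]) (∣p∪q∣≤∣p∣+∣q∣ q (p ─ q))
  where
  p⊆q∪[p─q] : p ⊆ q ∪ (p ─ q)
  p⊆q∪[p─q] {x} x∈p with x ∈? q
  ... | yes x∈q = x∈p∪q⁺ (inj₁ x∈q)
  ... | no  x∉q = x∈p∪q⁺ (inj₂ (x∈p∧x∉q⇒x∈p─q x∈p x∉q))

0<∣p∣⇒Nonempty : ∀ {p : Subset n} → 0 < ∣ p ∣ → Nonempty p
0<∣p∣⇒Nonempty {n} {p} 0<∣p∣ with nonempty? p
... | yes ne = ne
... | no ¬ne = ⊥-elim (n≮0 (subst (0 <_) (trans (cong ∣_∣ (Empty-unique ¬ne)) (∣⊥∣≡0 n)) 0<∣p∣))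

m<o∸n⇒m+n<o : ∀ m n o → m < o ∸ n → m + n < o
m<o∸n⇒m+n<o m zero    o       m<o rewrite +-identityʳ m = m<o
m<o∸n⇒m+n<o m (suc n) (suc o) m<o rewrite +-suc m n = s≤s (m<o∸n⇒m+n<o m n o m<o)

module _ {A : Set} (f : A → ℕ) where

  maxBy : List A → ℕ
  maxBy = foldr (λ x m → f x ⊔ m) 0

  ≤-maxBy : ∀ {x xs} → x List.∈ xs → f x ≤ maxBy xs
  ≤-maxBy {xs = y ∷ ys} (Any.here refl) = m≤m⊔n (f y) (maxBy ys)
  ≤-maxBy {xs = y ∷ ys} (Any.there x∈ys) = ≤-trans (≤-maxBy x∈ys) (m≤n⊔m (f y) (maxBy ys))

  maxBy-attained : ∀ xs → 0 < maxBy xs → ∃[ x ] x List.∈ xs × maxBy xs ≤ f x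
  maxBy-attained (y ∷ ys) pos with ≤-total (maxBy ys) (f y)
  ... | inj₁ ys≤y = y , Any.here refl , ≤-reflexive (m≥n⇒m⊔n≡m ys≤y)
  ... | inj₂ y≤ys with maxBy-attained ys (subst (0 <_) (m≤n⇒m⊔n≡n y≤ys) pos)
  ...   | x , x∈ys , ys≤x = x , Any.there x∈ys , subst (_≤ f x) (sym (m≤n⇒m⊔n≡n y≤ys)) ys≤x

∈-allSubsets : ∀ n (p : Subset n) → p List.∈ allSubsets n
∈-allSubsets zero    []            = Any.here refl
∈-allSubsets (suc n) (inside  ∷ p) = ∈-++⁺ˡ (∈-map⁺ (inside ∷_) (∈-allSubsets n p))
∈-allSubsets (suc n) (outside ∷ p) =
  ∈-++⁺ʳ (map (inside ∷_) (allSubsets n)) (∈-map⁺ (outside ∷_) (∈-allSubsets n p))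

module _ {P : Set} where

  T-does⁻ : (P? : Dec P) → T (does P?) → P
  T-does⁻ (yes p) _ = p

  T-does⁺ : (P? : Dec P) → P → T (does P?)
  T-does⁺ P? p = from T-≡ (dec-true P? p)

  T-not-does⁻ : (P? : Dec P) → T (not (does P?)) → ¬ P
  T-not-does⁻ (no ¬p) _ = ¬p

  T-not-does⁺ : (P? : Dec P) → ¬ P → T (not (does P?))
  T-not-does⁺ P? ¬p = from T-not-≡ (dec-false P? ¬p)

EdgeFree : List (Fin n × Fin n) → Subset n → Set
EdgeFree E S = ∀ a b → (a , b) List.∈ E → ¬ (a ∈ S × b ∈ S)

indepInB-sound : ∀ {E} {R' S : Subset n} → indepInB E R' S ≡ true → S ⊆ R' × EdgeFree E S
indepInB-sound {E = E} {R'} {S} indep with to T-∧ (from T-≡ indep)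
... | S⊆?R' , edgesOk =
  T-does⁻ (S ⊆? R') S⊆?R' ,
  λ a b e∈E → T-not-does⁻ ((a ∈? S) ×-dec (b ∈? S)) (All.lookup (all⁺ _ E edgesOk) e∈E)

indepInB-complete : ∀ {E} {R' S : Subset n} → S ⊆ R' → EdgeFree E S → indepInB E R' S ≡ true
indepInB-complete {E = E} {R'} {S} S⊆R' free =
  to T-≡ (from T-∧
    ( T-does⁺ (S ⊆? R') S⊆R'
    , all⁻ (λ e → not (does (proj₁ e ∈? S) ∧ does (proj₂ e ∈? S)))
        (All.tabulate λ { {a , b} e∈E → T-not-does⁺ ((a ∈? S) ×-dec (b ∈? S)) (free a b e∈E) })))

module _ {n} (I : Instance n) where
  open Instance I

  αR-maximal : ∀ {R' S} → S ⊆ R' → EdgeFree E S → ∣ S ∣ ≤ αR I R'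
  αR-maximal {R'} {S} S⊆R' free = ≤-maxBy ∣_∣
    (∈-filter⁺ (λ Y → indepInB E R' Y ≟ᵇ true) (∈-allSubsets n S) (indepInB-complete S⊆R' free))

  αR-attained : ∀ {R'} → 0 < αR I R' → ∃[ Y ] (Y ⊆ R' × EdgeFree E Y) × αR I R' ≤ ∣ Y ∣
  αR-attained {R'} 0<α with maxBy-attained ∣_∣ _ 0<α
  ... | Y , Y∈ , α≤∣Y∣ =
    Y , indepInB-sound (proj₂ (∈-filter⁻ (λ Y → indepInB E R' Y ≟ᵇ true) {xs = allSubsets n} Y∈)) , α≤∣Y∣

  ∈N⇒neighbour : ∀ {R' A v} → v ∈ N I R' A → ∃[ a ] a ∈ A × ((a , v) List.∈ E ⊎ (v , a) List.∈ E)
  ∈N⇒neighbour {R'} {A} {v} v∈N with find (any⁻ _ E (proj₂ (to T-∧ (from T-≡ v∈R'∧adjacent))))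
    where
    v∈R'∧adjacent : lookup R' v ∧ adjacentTo E A v ≡ true
    v∈R'∧adjacent = trans (sym (lookup∘tabulate _ v)) ([]=⇒lookup v∈N)
  ... | (a , b) , e∈E , adj with to T-∨ adj
  ... | inj₁ a∈A∧b≡v with to T-∧ a∈A∧b≡v
  ...   | a∈A , b≡v = a , T-does⁻ (a ∈? A) a∈A ,
    inj₁ (subst (λ w → (a , w) List.∈ E) (T-does⁻ (b ≟ᶠ v) b≡v) e∈E)
  ∈N⇒neighbour {R'} {A} {v} v∈N | (a , b) , e∈E , adj | inj₂ b∈A∧a≡v with to T-∧ b∈A∧a≡v
  ...   | b∈A , a≡v = b , T-does⁻ (b ∈? A) b∈A ,
    inj₂ (subst (λ w → (w , b) List.∈ E) (T-does⁻ (a ≟ᶠ v) a≡v) e∈E)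

  independent-avoids-N : ∀ {S A R'} → Independent I S → A ⊆ S → ∀ {v} → v ∈ S → v ∉ N I R' A
  independent-avoids-N {R' = R'} (_ , free , _) A⊆S v∈S v∈N with ∈N⇒neighbour {R'} v∈N
  ... | a , a∈A , inj₁ av∈E = free a _ av∈E (A⊆S a∈A , v∈S)
  ... | a , a∈A , inj₂ va∈E = free _ a va∈E (v∈S , A⊆S a∈A)

  ∣S∣≤∣X∣+α[R─N[A]] : ∀ {S A} → Independent I S → A ⊆ S → ∣ S ∣ ≤ ∣ X ∣ + αR I (R I ─ N I (R I) A)
  ∣S∣≤∣X∣+α[R─N[A]] {S} {A} indS@(S⊆V , free , _) A⊆S =
    ≤-trans (∣p∣≤∣q∣+∣p─q∣ S X) (+-monoʳ-≤ ∣ X ∣ (αR-maximal S─X⊆R─N free─X))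
    where
    S─X⊆R─N : S ─ X ⊆ R I ─ N I (R I) A
    S─X⊆R─N v∈S─X = x∈p∧x∉q⇒x∈p─q
      (x∈p∧x∉q⇒x∈p─q (S⊆V (p─q⊆p S X v∈S─X)) (x∈p─q⇒x∉q v∈S─X))
      (independent-avoids-N {R' = R I} indS A⊆S (p─q⊆p S X v∈S─X))
    free─X : EdgeFree E (S ─ X)
    free─X a b e∈E (a∈ , b∈) = free a b e∈E (p─q⊆p S X a∈ , p─q⊆p S X b∈)

  -- A hyperedge inside Y ⊆ R also lies in X, so it is empty, and then it lies inside S as well.
  edgeFree⊆R⇒Independent : ∀ {S Y} → (∀ h → h List.∈ H → h ⊆ X) → Independent I S →
                           Y ⊆ R I → EdgeFree E Y → Independent I Y
  edgeFree⊆R⇒Independent H⊆X (_ , _ , hyperfree) Y⊆R free =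
    (λ y∈Y → p─q⊆p V X (Y⊆R y∈Y)) , free ,
    λ h h∈H h⊆Y → hyperfree h h∈H λ x∈h → ⊥-elim (x∈p─q⇒x∉q (Y⊆R (h⊆Y x∈h)) (H⊆X h h∈H x∈h))

  ∣S∣<α[R] : ∀ {S A} → Independent I S → A ⊆ S → ∣ X ∣ < conf I (R I) A → ∣ S ∣ < αR I (R I)
  ∣S∣<α[R] indS A⊆S ∣X∣<conf = ≤-<-trans (∣S∣≤∣X∣+α[R─N[A]] indS A⊆S) (m<o∸n⇒m+n<o _ _ _ ∣X∣<conf)

  larger-independent⊆R : ∀ {S A} → (∀ h → h List.∈ H → h ⊆ X) → Independent I S → A ⊆ S →
                         ∣ X ∣ < conf I (R I) A → ∃[ Y ] Independent I Y × Y ⊆ R I × ∣ S ∣ < ∣ Y ∣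
  larger-independent⊆R H⊆X indS A⊆S ∣X∣<conf
    with αR-attained (≤-<-trans z≤n (∣S∣<α[R] indS A⊆S ∣X∣<conf))
  ... | Y , (Y⊆R , free) , α≤∣Y∣ =
    Y , edgeFree⊆R⇒Independent H⊆X indS Y⊆R free , Y⊆R , <-≤-trans (∣S∣<α[R] indS A⊆S ∣X∣<conf) α≤∣Y∣

incident-false : ∀ {u a b : Fin n} → a ≢ u → b ≢ u → incident u (a , b) ≡ false
incident-false {u = u} {a} {b} a≢u b≢u rewrite dec-false (a ≟ᶠ u) a≢u | dec-false (b ≟ᶠ u) b≢u = refl

module _ {n} (I : Instance n) (u : Fin n) where
  open Instance I

  Independent-deleteVertex⁻ : ∀ {S} → Independent (deleteVertex u I) S → Independent I S
  Independent-deleteVertex⁻ {S} (S⊆V-u , free , hyperfree) =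
    (λ x∈S → p─q⊆p V ⁅ u ⁆ (S⊆V-u x∈S)) , freeᴵ , hyperfreeᴵ
    where
    u∉S : u ∉ S
    u∉S u∈S = x∈p─q⇒x∉q (S⊆V-u u∈S) (x∈⁅x⁆ u)
    freeᴵ : EdgeFree E S
    freeᴵ a b e∈E (a∈S , b∈S) = free a b
      (∈-filter⁺ (λ e → incident u e ≟ᵇ false) e∈E
        (incident-false {a = a} {b} (λ { refl → u∉S a∈S }) (λ { refl → u∉S b∈S })))
      (a∈S , b∈S)
    hyperfreeᴵ : ∀ h → h List.∈ H → ¬ h ⊆ S
    hyperfreeᴵ h h∈H h⊆S with u ∈? h
    ... | yes u∈h = u∉S (h⊆S u∈h)
    ... | no  u∉h = hyperfree h
      (∈-filter⁺ (λ h → does (u ∈? h) ≟ᵇ false) h∈H (dec-false (u ∈? h) u∉h)) h⊆S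

  Independent-deleteVertex⁺ : ∀ {S} → Independent I S → u ∉ S → Independent (deleteVertex u I) S
  Independent-deleteVertex⁺ (S⊆V , free , hyperfree) u∉S =
    (λ x∈S → x∈p∧x≢y⇒x∈p-y (S⊆V x∈S) λ { refl → u∉S x∈S }) ,
    (λ a b e∈E → free a b (proj₁ (∈-filter⁻ (λ e → incident u e ≟ᵇ false) {xs = E} e∈E))) ,
    (λ h h∈H → hyperfree h (proj₁ (∈-filter⁻ (λ h → does (u ∈? h) ≟ᵇ false) {xs = H} h∈H)))

module _ {n} (I : Instance n) (X' : Subset n) where

  Independent-addHyperedge⁻ : ∀ {S} → Independent (addHyperedge X' I) S → Independent I S
  Independent-addHyperedge⁻ (S⊆V , free , hyperfree) = S⊆V , free , λ h h∈H → hyperfree h (Any.there h∈H)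

  Independent-addHyperedge⁺ : ∀ {S} → Independent I S → ¬ X' ⊆ S → Independent (addHyperedge X' I) S
  Independent-addHyperedge⁺ (S⊆V , free , hyperfree) X'⊈S =
    S⊆V , free , λ { h (Any.here refl) → X'⊈S ; h (Any.there h∈H) → hyperfree h h∈H }

Answer-⇔ : (J I : Instance n) → Instance.k J ≡ Instance.k I →
           (∀ {S} → Independent J S → Independent I S) →
           (∀ {S} → Independent I S → ∃[ Y ] Independent J Y × ∣ S ∣ ≤ ∣ Y ∣) →
           Answer J ⇔ Answer I
Answer-⇔ _ _ kJ≡kI J⇒I dominated = mk⇔
  (λ (S , indS , kJ≤∣S∣) → S , J⇒I indS , subst (_≤ ∣ S ∣) kJ≡kI kJ≤∣S∣)
  (λ (S , indS , kI≤∣S∣) → let Y , indY , ∣S∣≤∣Y∣ = dominated indS in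
    Y , indY , subst (_≤ ∣ Y ∣) (sym kJ≡kI) (≤-trans kI≤∣S∣ ∣S∣≤∣Y∣))

module _ {n} (I : Instance n) (H⊆X : ∀ h → h List.∈ Instance.H I → h ⊆ Instance.X I) where
  open Instance I

  deleteVertex-equivalent : ∀ {u} → u ∈ X → ∣ X ∣ < conf I (R I) ⁅ u ⁆ →
                            Answer (deleteVertex u I) ⇔ Answer I
  deleteVertex-equivalent {u} u∈X ∣X∣<conf =
    Answer-⇔ (deleteVertex u I) I refl (Independent-deleteVertex⁻ I u) dominated
    where
    dominated : ∀ {S} → Independent I S → ∃[ Y ] Independent (deleteVertex u I) Y × ∣ S ∣ ≤ ∣ Y ∣
    dominated {S} indS with u ∈? S
    ... | no  u∉S = S , Independent-deleteVertex⁺ I u indS u∉S , ≤-refl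
    ... | yes u∈S with larger-independent⊆R I H⊆X indS (x∈p⇒⁅x⁆⊆p u∈S) ∣X∣<conf
    ...   | Y , indY , Y⊆R , ∣S∣<∣Y∣ =
      Y , Independent-deleteVertex⁺ I u indY (λ u∈Y → x∈p─q⇒x∉q (Y⊆R u∈Y) u∈X) , <⇒≤ ∣S∣<∣Y∣

  addHyperedge-equivalent : ∀ {X'} → X' ⊆ X → 0 < ∣ X' ∣ → ∣ X ∣ < conf I (R I) X' →
                            Answer (addHyperedge X' I) ⇔ Answer I
  addHyperedge-equivalent {X'} X'⊆X 0<∣X'∣ ∣X∣<conf =
    Answer-⇔ (addHyperedge X' I) I refl (Independent-addHyperedge⁻ I X') dominated
    where
    dominated : ∀ {S} → Independent I S → ∃[ Y ] Independent (addHyperedge X' I) Y × ∣ S ∣ ≤ ∣ Y ∣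
    dominated {S} indS with X' ⊆? S
    ... | no  X'⊈S = S , Independent-addHyperedge⁺ I X' indS X'⊈S , ≤-refl
    ... | yes X'⊆S with larger-independent⊆R I H⊆X indS X'⊆S ∣X∣<conf | 0<∣p∣⇒Nonempty 0<∣X'∣
    ...   | Y , indY , Y⊆R , ∣S∣<∣Y∣ | x , x∈X' =
      Y , Independent-addHyperedge⁺ I X' indY (λ X'⊆Y → x∈p─q⇒x∉q (Y⊆R (X'⊆Y x∈X')) (X'⊆X x∈X')) ,
      <⇒≤ ∣S∣<∣Y∣

lemma3 : (c : ℕ) → 1 ≤ c → (n : ℕ) → (I : Instance n) → ValidInstance c I →
    ((u : Fin n) → u ∈ Instance.X I → ∣ Instance.X I ∣ < conf I (R I) ⁅ u ⁆ →
       Answer (deleteVertex u I) ⇔ Answer I) ×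
    ((X' : Subset n) → Chunk c I X' → ∣ Instance.X I ∣ < conf I (R I) X' →
       Answer (addHyperedge X' I) ⇔ Answer I)
lemma3 _ _ _ I (_ , _ , H⊆X , _ , _) =
  (λ _ u∈X → deleteVertex-equivalent I H⊆X u∈X) ,
  (λ _ (X'⊆X , 0<∣X'∣ , _ , _) → addHyperedge-equivalent I H⊆X X'⊆X 0<∣X'∣)
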